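{- Let $G$ be a Lehman graph of type $(3s-1,3,s)$ (so $k=1$), and let $e=w_Lb_R$ and $f=w_Rb_L$ be edges of $G$ ($w_L,w_R$ white, $b_L,b_R$ black). If $w_Lb_L$ is a rung of $G$, then $G{\uparrow}\{e,f\}$ is a Lehman graph of type $(3(s+1)-1,3,s+1)$.
   Context: A bipartite graph $G$ with $n$ black and $n$ white vertices has bipartite adjacency matrix $A$ (rows indexed by black vertices, columns by white vertices, entry $1$ iff adjacent). A matrix is $r$-regular if all row and column sums equal $r$. $G$ is a Lehman graph of type $(n,r,s)$ if $A$ is $r$-regular and there is an $s$-regular $n\times n$ $(0,1)$-matrix $B$ with $AB^T=J+kI$, where $k=rs-n\in\{ -1,1,2,3,\ldots\}$, $J$ is the all-ones matrix and $I$ the identity. When $G$ is cubic with $k=1$, the edges $bw$ of $G$ with $B(b,w)=0$ form a perfect matching; these edges are called the rungs of $G$. For non-incident edges $e=w_Lb_R$, $f=w_Rb_L$, the graph $G{\uparrow}\{e,f\}$ is obtained from $G$ by deleting $e$ and $f$, adding new black vertices $b_0,b_1,b_2$ and white vertices $w_0,w_1,w_2$ with edges $b_0w_0,b_1w_1,b_2w_2,b_0w_1,b_2w_1,b_1w_0,b_1w_2$, and adding the edges $b_Lw_0$, $b_Rw_2$, $b_0w_L$, $b_2w_R$. -}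

module Defs where

open import Data.Bool using (Bool; true; false; if_then_else_; _∧_; _∨_; not)
open import Data.Nat using (ℕ; zero; suc)
import Data.Nat as ℕ
open import Data.Fin using (Fin; zero; suc)
import Data.Fin as F
open import Data.Integer using (ℤ; +_; -[1+_]; _+_; _*_; _-_; _≤_)
open import Data.Product using (Σ; _×_; _,_)
open import Data.Sum using (_⊎_)
open import Relation.Nullary.Decidable using (⌊_⌋)
open import Relation.Binary.PropositionalEquality using (_≡_)

-- An n×n (0,1)-matrix; for a bipartite adjacency matrix rows are black
-- vertices, columns are white vertices, entry true iff adjacent.
BMat : ℕ → Set
BMat n = Fin n → Fin n → Bool

toℤ : Bool → ℤ
toℤ true  = + 1
toℤ false = + 0

sumFin : ∀ n → (Fin n → ℤ) → ℤ
sumFin zero    f = + 0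
sumFin (suc n) f = f zero + sumFin n (λ i → f (suc i))

Regular : ∀ n → ℕ → BMat n → Set
Regular n r M =
  (∀ i → sumFin n (λ j → toℤ (M i j)) ≡ + r) ×
  (∀ j → sumFin n (λ i → toℤ (M i j)) ≡ + r)

kOf : ℕ → ℕ → ℕ → ℤ
kOf n r s = + (r ℕ.* s) - + n

prodT : ∀ n → BMat n → BMat n → Fin n → Fin n → ℤ
prodT n A B i j = sumFin n (λ l → toℤ (A i l) * toℤ (B j l))

JkI : ∀ n → ℤ → Fin n → Fin n → ℤ
JkI n k i j = + 1 + (if ⌊ i F.≟ j ⌋ then k else + 0)

LehmanWitness : ∀ n → ℕ → ℕ → BMat n → BMat n → Set
LehmanWitness n r s A B =
  Regular n r A ×
  Regular n s B ×
  (kOf n r s ≡ -[1+ 0 ] ⊎ + 1 ≤ kOf n r s) ×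
  (∀ i j → prodT n A B i j ≡ JkI n (kOf n r s) i j)

Lehman : ∀ n → ℕ → ℕ → BMat n → Set
Lehman n r s A = Σ (BMat n) (λ B → LehmanWitness n r s A B)

-- For cubic G with k = 1 and witness B: the edge bw is a rung
IsRung : ∀ {n} → BMat n → BMat n → Fin n → Fin n → Set
IsRung A B b w = (A b w ≡ true) × (B b w ≡ false)

-- Vertices of G↑{e,f} (n+3 of each colour):
-- black: zero = b₀, suc zero = b₁, suc (suc zero) = b₂, suc (suc (suc b)) = old b
-- white: analogously w₀, w₁, w₂, old w.
-- e = w_L b_R, f = w_R b_L.
up : ∀ {n} → BMat n → (bL bR wL wR : Fin n) → BMat (3 ℕ.+ n)
up A bL bR wL wR zero zero = true
up A bL bR wL wR zero (suc zero) = true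
up A bL bR wL wR zero (suc (suc zero)) = false
up A bL bR wL wR zero (suc (suc (suc w))) = ⌊ w F.≟ wL ⌋
up A bL bR wL wR (suc zero) zero = true
up A bL bR wL wR (suc zero) (suc zero) = true
up A bL bR wL wR (suc zero) (suc (suc zero)) = true
up A bL bR wL wR (suc zero) (suc (suc (suc w))) = false
up A bL bR wL wR (suc (suc zero)) zero = false
up A bL bR wL wR (suc (suc zero)) (suc zero) = true
up A bL bR wL wR (suc (suc zero)) (suc (suc zero)) = true
up A bL bR wL wR (suc (suc zero)) (suc (suc (suc w))) = ⌊ w F.≟ wR ⌋
up A bL bR wL wR (suc (suc (suc b))) zero = ⌊ b F.≟ bL ⌋
up A bL bR wL wR (suc (suc (suc b))) (suc zero) = false
up A bL bR wL wR (suc (suc (suc b))) (suc (suc zero)) = ⌊ b F.≟ bR ⌋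
up A bL bR wL wR (suc (suc (suc b))) (suc (suc (suc w))) =
  A b w ∧ not ((⌊ b F.≟ bR ⌋ ∧ ⌊ w F.≟ wL ⌋) ∨ (⌊ b F.≟ bL ⌋ ∧ ⌊ w F.≟ wR ⌋))

module Submission where

-- With k = 1, J = A·1 gives A (3B − J)ᵀ = 3I, so A is injective over ℤ (any n + 1 vectors of ℤⁿ are
-- linearly dependent), which turns A Bᵀ = J + I into Bᵀ A = J + I.  Counting along the rung b_L w_L with
-- these two identities gives B(b_R,w_L) = B(b_L,w_R) = 1, B(b_R,w_R) = 0, and disjoint B-neighbourhoods
-- for b_L, b_R and for w_L, w_R.  That is exactly what makes the witness B↑ of G↑{e,f} work: B on the old
-- vertices, b₀ and b₂ copying the B-rows of b_R and b_L, w₀ and w₂ the B-columns of w_R and w_L, and b₁, w₁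
-- joined to the complements of those two neighbourhoods; it is (s+1)-regular and A↑ B↑ᵀ = J + I block by block.

open import Defs

module IntegerMatrices where

  open import Data.Bool using (true; false; _∧_; _∨_; not)
  open import Data.Nat using (zero; suc; _<_; s≤s)
  import Data.Nat as ℕ
  import Data.Nat.Properties as ℕ
  open import Data.Fin using (Fin; zero; suc; punchIn; punchOut)
  open import Data.Fin.Properties using (_≟_; punchInᵢ≢i; all?; ¬∀⟶∃¬)
  open import Data.Integer using (ℤ; +_; 0ℤ; 1ℤ; _+_; _*_; _-_; -_; _≤_; +≤+)
  import Data.Integer.Properties as ℤ
  open import Data.Integer.Tactic.RingSolver using (solve-∀)
  open import Algebra.Properties.Semiring.Sum ℤ.+-*-semiring
    using (sum; sum-syntax; sum-remove; sum-cong-≗; sum-replicate-zero; ∑-comm; ∑-distrib-+;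
           *-distribˡ-sum; *-distribʳ-sum)
  open import Data.Vec.Functional using (_∷_; insertAt; removeAt)
  open import Data.Vec.Functional.Properties using (insertAt-lookup; insertAt-punchIn; removeAt-punchOut)
  open import Data.Product using (∃; _×_; _,_; proj₁; proj₂)
  open import Data.Sum using ([_,_]′)
  open import Data.Empty using (⊥; ⊥-elim)
  open import Function using (id)
  open import Relation.Nullary using (¬_; yes; no; contradiction)
  open import Relation.Nullary.Decidable using (⌊_⌋)
  open import Relation.Binary.PropositionalEquality

  δ : ∀ {n} → Fin n → Fin n → ℤ
  δ i j = toℤ ⌊ i ≟ j ⌋

  δ-refl : ∀ {n} (i : Fin n) → δ i i ≡ 1ℤ
  δ-refl i with i ≟ i
  ... | yes _ = refl
  ... | no i≢i = contradiction refl i≢i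

  δ-≢ : ∀ {n} {i j : Fin n} → i ≢ j → δ i j ≡ 0ℤ
  δ-≢ {i = i} {j} i≢j with i ≟ j
  ... | yes i≡j = contradiction i≡j i≢j
  ... | no _ = refl

  δ-sym : ∀ {n} (i j : Fin n) → δ i j ≡ δ j i
  δ-sym i j with i ≟ j | j ≟ i
  ... | yes _ | yes _ = refl
  ... | no _ | no _ = refl
  ... | yes i≡j | no j≢i = contradiction (sym i≡j) j≢i
  ... | no i≢j | yes j≡i = contradiction (sym j≡i) i≢j

  δ-suc : ∀ {n} (i j : Fin n) → δ {suc n} (suc i) (suc j) ≡ δ i j
  δ-suc i j with i ≟ j
  ... | yes _ = refl
  ... | no _ = refl

  sumFin≡∑ : ∀ n (f : Fin n → ℤ) → sumFin n f ≡ ∑[ i < n ] f i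
  sumFin≡∑ zero f = refl
  sumFin≡∑ (suc n) f = cong (λ t → f zero + t) (sumFin≡∑ n (λ i → f (suc i)))

  ∑-zero : ∀ {n} {f : Fin n → ℤ} → (∀ i → f i ≡ 0ℤ) → ∑[ i < n ] f i ≡ 0ℤ
  ∑-zero {n} f≗0 = trans (sum-cong-≗ f≗0) (sum-replicate-zero n)

  ∑-distrib-minus : ∀ {n} (f g : Fin n → ℤ) → ∑[ i < n ] (f i - g i) ≡ ∑[ i < n ] f i - ∑[ i < n ] g i
  ∑-distrib-minus {zero} f g = refl
  ∑-distrib-minus {suc n} f g = begin
    f zero - g zero + ∑[ i < n ] (f (suc i) - g (suc i))
      ≡⟨ cong (λ t → f zero - g zero + t) (∑-distrib-minus (λ i → f (suc i)) (λ i → g (suc i))) ⟩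
    f zero - g zero + (∑[ i < n ] f (suc i) - ∑[ i < n ] g (suc i))
      ≡⟨ shuffle (f zero) (g zero) _ _ ⟩
    f zero + ∑[ i < n ] f (suc i) - (g zero + ∑[ i < n ] g (suc i)) ∎
    where
    open ≡-Reasoning
    shuffle : ∀ a b c d → a - b + (c - d) ≡ a + c - (b + d)
    shuffle = solve-∀

  ∑-δˡ : ∀ {n} (k : Fin n) (f : Fin n → ℤ) → ∑[ i < n ] (δ i k * f i) ≡ f k
  ∑-δˡ {suc n} k f = begin
    ∑[ i < suc n ] (δ i k * f i)                           ≡⟨ sum-remove {i = k} (λ i → δ i k * f i) ⟩
    δ k k * f k + ∑[ j < n ] (δ (punchIn k j) k * f (punchIn k j))
      ≡⟨ cong₂ _+_ (cong (_* f k) (δ-refl k)) (∑-zero (λ j → cong (_* f (punchIn k j)) (δ-≢ (punchInᵢ≢i k j)))) ⟩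
    1ℤ * f k + 0ℤ                                         ≡⟨ ℤ.+-identityʳ _ ⟩
    1ℤ * f k                                              ≡⟨ ℤ.*-identityˡ _ ⟩
    f k ∎
    where open ≡-Reasoning

  ∑-δʳ : ∀ {n} (k : Fin n) (f : Fin n → ℤ) → ∑[ i < n ] (δ k i * f i) ≡ f k
  ∑-δʳ k f = trans (sum-cong-≗ (λ i → cong (_* f i) (δ-sym k i))) (∑-δˡ k f)

  ∑-δ : ∀ {n} (k : Fin n) → ∑[ i < n ] δ i k ≡ 1ℤ
  ∑-δ k = trans (sum-cong-≗ (λ i → sym (ℤ.*-identityʳ (δ i k)))) (∑-δˡ k (λ _ → 1ℤ))

  ∑-one : ∀ n → ∑[ i < n ] 1ℤ ≡ + n
  ∑-one zero = refl
  ∑-one (suc n) = cong (λ t → 1ℤ + t) (∑-one n)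

  ∑-scaleˡ : ∀ {n} c (f : Fin n → ℤ) → ∑[ i < n ] (c * f i) ≡ c * ∑[ i < n ] f i
  ∑-scaleˡ c f = sym (*-distribˡ-sum c f)

  ∑-scaleʳ : ∀ {n} c (f : Fin n → ℤ) → ∑[ i < n ] (f i * c) ≡ ∑[ i < n ] f i * c
  ∑-scaleʳ c f = sym (*-distribʳ-sum c f)

  ∑-nonneg : ∀ {n} {f : Fin n → ℤ} → (∀ i → 0ℤ ≤ f i) → 0ℤ ≤ ∑[ i < n ] f i
  ∑-nonneg {zero} _ = ℤ.≤-refl
  ∑-nonneg {suc n} f≥0 = ℤ.+-mono-≤ (f≥0 zero) (∑-nonneg (λ i → f≥0 (suc i)))

  ∑≢1-of-two-units : ∀ {n} {f : Fin n → ℤ} {a b : Fin n} → (∀ i → 0ℤ ≤ f i) → a ≢ b →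
    f a ≡ 1ℤ → f b ≡ 1ℤ → ∑[ i < n ] f i ≢ 1ℤ
  ∑≢1-of-two-units {suc zero} {a = zero} {zero} _ a≢b = contradiction refl a≢b
  ∑≢1-of-two-units {suc (suc n)} {f} {a} {b} f≥0 a≢b fa≡1 fb≡1 ∑≡1 = 2≰1 (begin
    + 2                          ≤⟨ ℤ.+-monoʳ-≤ 1ℤ (ℤ.+-monoʳ-≤ 1ℤ (∑-nonneg {f = f∖a∖b} (λ _ → f≥0 _))) ⟩
    1ℤ + (1ℤ + sum f∖a∖b)         ≡⟨ cong₂ (λ x y → x + (y + sum f∖a∖b)) fa≡1 fb≡1 ⟨
    f a + (f b + sum f∖a∖b)       ≡⟨ cong (λ x → f a + (x + sum f∖a∖b)) (removeAt-punchOut f a≢b) ⟨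
    f a + (f∖a b′ + sum f∖a∖b)    ≡⟨ cong (λ x → f a + x) (sum-remove {i = b′} f∖a) ⟨
    f a + sum f∖a                 ≡⟨ sum-remove {i = a} f ⟨
    sum f                        ≡⟨ ∑≡1 ⟩
    1ℤ ∎)
    where
    open ℤ.≤-Reasoning
    b′ : Fin (suc n)
    b′ = punchOut a≢b
    f∖a : Fin (suc n) → ℤ
    f∖a = removeAt f a
    f∖a∖b : Fin n → ℤ
    f∖a∖b = removeAt f∖a b′
    2≰1 : ¬ (+ 2 ≤ 1ℤ)
    2≰1 (+≤+ (s≤s ()))

  toℤ-nonneg : ∀ x → 0ℤ ≤ toℤ x
  toℤ-nonneg true = +≤+ ℕ.z≤n
  toℤ-nonneg false = +≤+ ℕ.z≤n

  toℤ-∧ : ∀ x y → toℤ (x ∧ y) ≡ toℤ x * toℤ y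
  toℤ-∧ true true = refl
  toℤ-∧ true false = refl
  toℤ-∧ false y = refl

  toℤ-*-nonneg : ∀ x y → 0ℤ ≤ toℤ x * toℤ y
  toℤ-*-nonneg x y = subst (0ℤ ≤_) (toℤ-∧ x y) (toℤ-nonneg (x ∧ y))

  toℤ-not : ∀ x → toℤ (not x) ≡ 1ℤ - toℤ x
  toℤ-not true = refl
  toℤ-not false = refl

  toℤ-nor : ∀ {x y} → (x ≡ true → y ≡ true → ⊥) → toℤ (not (x ∨ y)) ≡ 1ℤ - toℤ x - toℤ y
  toℤ-nor {true} {true} x∧y = ⊥-elim (x∧y refl refl)
  toℤ-nor {true} {false} _ = refl
  toℤ-nor {false} {true} _ = refl
  toℤ-nor {false} {false} _ = refl

  toℤ-∧-nor : ∀ {x p q} → (p ≡ true → x ≡ true) → (q ≡ true → x ≡ true) → (p ≡ true → q ≡ true → ⊥) →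
    toℤ (x ∧ not (p ∨ q)) ≡ toℤ x - toℤ p - toℤ q
  toℤ-∧-nor {true} _ _ p∧q = toℤ-nor p∧q
  toℤ-∧-nor {false} {false} {false} _ _ _ = refl
  toℤ-∧-nor {false} {true} p⇒x _ _ with p⇒x refl
  ... | ()
  toℤ-∧-nor {false} {false} {true} _ q⇒x _ with q⇒x refl
  ... | ()

  LinearlyDependent : ∀ {m n} → (Fin m → Fin n → ℤ) → Set
  LinearlyDependent {m} {n} v =
    ∃ λ (c : Fin m → ℤ) → (∃ λ k → c k ≢ 0ℤ) × (∀ w → ∑[ j < m ] (c j * v j w) ≡ 0ℤ)

  eliminate : ∀ {m n} → (Fin (suc m) → Fin (suc n) → ℤ) → Fin (suc m) → Fin m → Fin (suc n) → ℤ
  eliminate v k j w = v k zero * v (punchIn k j) w - v (punchIn k j) zero * v k w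

  eliminate-zero : ∀ {m n} v (k : Fin (suc m)) (j : Fin m) → eliminate {n = n} v k j zero ≡ 0ℤ
  eliminate-zero v k j = cancel (v k zero) (v (punchIn k j) zero)
    where
    cancel : ∀ p q → p * q - q * p ≡ 0ℤ
    cancel = solve-∀

  lift-dependence : ∀ {m n} (v : Fin (suc m) → Fin (suc n) → ℤ) (k : Fin (suc m)) → v k zero ≢ 0ℤ →
    LinearlyDependent (λ j w → eliminate v k j (suc w)) → LinearlyDependent v
  lift-dependence {m} {n} v k p≢0 (μ , (j₀ , μj₀≢0) , μ-rel) = c , (punchIn k j₀ , c-nontrivial) , c-rel
    where
    p : ℤ
    p = v k zero
    σ : Fin m → Fin (suc m)
    σ = punchIn k
    S : ℤ
    S = ∑[ j < m ] (μ j * v (σ j) zero)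
    c : Fin (suc m) → ℤ
    c = insertAt (λ j → p * μ j) k (- S)
    c-nontrivial : c (σ j₀) ≢ 0ℤ
    c-nontrivial c≡0 = [ p≢0 , μj₀≢0 ]′ (ℤ.i*j≡0⇒i≡0∨j≡0 p (trans (sym (insertAt-punchIn _ k (- S) j₀)) c≡0))
    combination : ∀ w → ∑[ i < suc m ] (c i * v i w) ≡ ∑[ j < m ] (μ j * eliminate v k j w)
    combination w = begin
      ∑[ i < suc m ] (c i * v i w)
        ≡⟨ sum-remove {i = k} (λ i → c i * v i w) ⟩
      c k * v k w + ∑[ j < m ] (c (σ j) * v (σ j) w)
        ≡⟨ cong₂ (λ x y → x * v k w + y) (insertAt-lookup _ k (- S))
                 (sum-cong-≗ (λ j → cong (_* v (σ j) w) (insertAt-punchIn _ k (- S) j))) ⟩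
      - S * v k w + ∑[ j < m ] (p * μ j * v (σ j) w)
        ≡⟨ commute S (v k w) _ ⟩
      ∑[ j < m ] (p * μ j * v (σ j) w) - S * v k w
        ≡⟨ cong (λ x → ∑[ j < m ] (p * μ j * v (σ j) w) - x) (∑-scaleʳ (v k w) (λ j → μ j * v (σ j) zero)) ⟨
      ∑[ j < m ] (p * μ j * v (σ j) w) - ∑[ j < m ] (μ j * v (σ j) zero * v k w)
        ≡⟨ ∑-distrib-minus (λ j → p * μ j * v (σ j) w) (λ j → μ j * v (σ j) zero * v k w) ⟨
      ∑[ j < m ] (p * μ j * v (σ j) w - μ j * v (σ j) zero * v k w)
        ≡⟨ sum-cong-≗ (λ j → factor p (μ j) (v (σ j) w) (v (σ j) zero) (v k w)) ⟩
      ∑[ j < m ] (μ j * eliminate v k j w) ∎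
      where
      open ≡-Reasoning
      commute : ∀ a b c → - a * b + c ≡ c - a * b
      commute = solve-∀
      factor : ∀ p μ x y z → p * μ * x - μ * y * z ≡ μ * (p * x - y * z)
      factor = solve-∀
    c-rel : ∀ w → ∑[ i < suc m ] (c i * v i w) ≡ 0ℤ
    c-rel zero = trans (combination zero)
      (∑-zero (λ j → trans (cong (μ j *_) (eliminate-zero v k j)) (ℤ.*-zeroʳ (μ j))))
    c-rel (suc w) = trans (combination (suc w)) (μ-rel w)

  linearlyDependent : ∀ {m n} → n < m → (v : Fin m → Fin n → ℤ) → LinearlyDependent v
  linearlyDependent {suc m} {zero} _ v = (λ _ → 1ℤ) , (zero , λ ()) , λ ()
  linearlyDependent {suc m} {suc n} (s≤s n<m) v with all? (λ j → v j zero ℤ.≟ 0ℤ)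
  ... | no ¬all-zero = lift-dependence v (proj₁ pivot) (proj₂ pivot) (linearlyDependent n<m _)
    where
    pivot : ∃ λ k → v k zero ≢ 0ℤ
    pivot = ¬∀⟶∃¬ (suc m) _ (λ j → v j zero ℤ.≟ 0ℤ) ¬all-zero
  ... | yes all-zero with linearlyDependent (ℕ.m<n⇒m<1+n n<m) (λ j w → v j (suc w))
  ...   | c , nontrivial , c-rel = c , nontrivial , λ
    { zero    → ∑-zero (λ j → trans (cong (c j *_) (all-zero j)) (ℤ.*-zeroʳ (c j)))
    ; (suc w) → c-rel w }

  relation-image : ∀ {m n p} (M : Fin p → Fin n → ℤ) {v : Fin m → Fin n → ℤ} {c : Fin m → ℤ} →
    (∀ w → ∑[ j < m ] (c j * v j w) ≡ 0ℤ) → ∀ i → ∑[ j < m ] (c j * ∑[ w < n ] (M i w * v j w)) ≡ 0ℤ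
  relation-image {m} {n} M {v} {c} c-rel i = begin
    ∑[ j < m ] (c j * ∑[ w < n ] (M i w * v j w))
      ≡⟨ sum-cong-≗ (λ j → trans (*-distribˡ-sum (c j) (λ w → M i w * v j w))
                                 (sum-cong-≗ (λ w → rearrange (c j) (M i w) (v j w)))) ⟩
    ∑[ j < m ] ∑[ w < n ] (M i w * (c j * v j w))
      ≡⟨ ∑-comm (λ j w → M i w * (c j * v j w)) ⟩
    ∑[ w < n ] ∑[ j < m ] (M i w * (c j * v j w))
      ≡⟨ sum-cong-≗ (λ w → trans (∑-scaleˡ (M i w) (λ j → c j * v j w)) (cong (M i w *_) (c-rel w))) ⟩
    ∑[ w < n ] (M i w * 0ℤ)
      ≡⟨ ∑-zero (λ w → ℤ.*-zeroʳ (M i w)) ⟩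
    0ℤ ∎
    where
    open ≡-Reasoning
    rearrange : ∀ a b c → a * (b * c) ≡ b * (a * c)
    rearrange = solve-∀

  -- x, C₁, …, Cₙ are n + 1 vectors in ℤⁿ; applying M to a relation among them kills every coefficient of the Cⱼ.
  rightInverse⇒injective : ∀ {n} {d : ℤ} (M C : Fin n → Fin n → ℤ) → d ≢ 0ℤ →
    (∀ i j → ∑[ w < n ] (M i w * C j w) ≡ d * δ i j) →
    (x : Fin n → ℤ) → (∀ i → ∑[ w < n ] (M i w * x w) ≡ 0ℤ) → ∀ w → x w ≡ 0ℤ
  rightInverse⇒injective {n} {d} M C d≢0 MC≡dI x Mx≡0 w = x-zero
    where
    v : Fin (suc n) → Fin n → ℤ
    v = x ∷ C
    dependence : LinearlyDependent v
    dependence = linearlyDependent (ℕ.n<1+n n) v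
    c : Fin (suc n) → ℤ
    c = proj₁ dependence
    c-rel : ∀ w → ∑[ j < suc n ] (c j * v j w) ≡ 0ℤ
    c-rel = proj₂ (proj₂ dependence)
    c-suc : ∀ i → c (suc i) ≡ 0ℤ
    c-suc i = [ (λ d≡0 → contradiction d≡0 d≢0) , id ]′ (ℤ.i*j≡0⇒i≡0∨j≡0 d (begin
      d * c (suc i)
        ≡⟨ ∑-δʳ i (λ j → d * c (suc j)) ⟨
      ∑[ j < n ] (δ i j * (d * c (suc j)))
        ≡⟨ sum-cong-≗ (λ j → trans (swap (δ i j) d (c (suc j))) (cong (c (suc j) *_) (sym (MC≡dI i j)))) ⟩
      ∑[ j < n ] (c (suc j) * ∑[ w < n ] (M i w * C j w))
        ≡⟨ ℤ.+-identityˡ _ ⟨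
      0ℤ + ∑[ j < n ] (c (suc j) * ∑[ w < n ] (M i w * C j w))
        ≡⟨ cong (λ t → t + ∑[ j < n ] (c (suc j) * ∑[ w < n ] (M i w * C j w)))
                (trans (sym (ℤ.*-zeroʳ (c zero))) (cong (c zero *_) (sym (Mx≡0 i)))) ⟩
      ∑[ j < suc n ] (c j * ∑[ w < n ] (M i w * v j w))
        ≡⟨ relation-image M {v} {c} c-rel i ⟩
      0ℤ ∎))
      where
      open ≡-Reasoning
      swap : ∀ a b c → a * (b * c) ≡ c * (b * a)
      swap = solve-∀
    c-zero : c zero ≢ 0ℤ
    c-zero with proj₁ (proj₂ dependence)
    ... | zero , c₀≢0 = c₀≢0
    ... | suc i , cᵢ≢0 = contradiction (c-suc i) cᵢ≢0
    c₀x≡0 : c zero * x w ≡ 0ℤ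
    c₀x≡0 = begin
      c zero * x w
        ≡⟨ ℤ.+-identityʳ _ ⟨
      c zero * x w + 0ℤ
        ≡⟨ cong (λ t → c zero * x w + t) (∑-zero (λ j → trans (cong (_* C j w) (c-suc j)) (ℤ.*-zeroˡ (C j w)))) ⟨
      ∑[ j < suc n ] (c j * v j w)
        ≡⟨ c-rel w ⟩
      0ℤ ∎
      where open ≡-Reasoning
    x-zero : x w ≡ 0ℤ
    x-zero = [ (λ c₀≡0 → contradiction c₀≡0 c-zero) , id ]′ (ℤ.i*j≡0⇒i≡0∨j≡0 (c zero) c₀x≡0)

  ⟦_⟧ : ∀ {n} → BMat n → Fin n → Fin n → ℤ
  ⟦ M ⟧ i j = toℤ (M i j)

  module _ {n r} {k : ℤ} (A B : BMat n)
    (rowA : ∀ i → ∑[ w < n ] ⟦ A ⟧ i w ≡ + r) (colA : ∀ w → ∑[ i < n ] ⟦ A ⟧ i w ≡ + r)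
    (AB : ∀ i j → ∑[ w < n ] (⟦ A ⟧ i w * ⟦ B ⟧ j w) ≡ 1ℤ + k * δ i j)
    where

    private
      a b : Fin n → Fin n → ℤ
      a = ⟦ A ⟧
      b = ⟦ B ⟧

    rB−J : Fin n → Fin n → ℤ
    rB−J j w = + r * b j w - 1ℤ

    A-rB−J-diagonal : ∀ i j → ∑[ w < n ] (a i w * rB−J j w) ≡ + r * k * δ i j
    A-rB−J-diagonal i j = begin
      ∑[ w < n ] (a i w * rB−J j w)                  ≡⟨ sum-cong-≗ (λ w → expand (+ r) (a i w) (b j w)) ⟩
      ∑[ w < n ] (+ r * (a i w * b j w) - a i w)     ≡⟨ ∑-distrib-minus (λ w → + r * (a i w * b j w)) (a i) ⟩
      ∑[ w < n ] (+ r * (a i w * b j w)) - ∑[ w < n ] a i w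
        ≡⟨ cong₂ _-_ (trans (∑-scaleˡ (+ r) (λ w → a i w * b j w)) (cong (+ r *_) (AB i j))) (rowA i) ⟩
      + r * (1ℤ + k * δ i j) - + r                   ≡⟨ collect (+ r) k (δ i j) ⟩
      + r * k * δ i j ∎
      where
      open ≡-Reasoning
      expand : ∀ ρ x y → x * (ρ * y - 1ℤ) ≡ ρ * (x * y) - x
      expand = solve-∀
      collect : ∀ ρ κ d → ρ * (1ℤ + κ * d) - ρ ≡ ρ * κ * d
      collect = solve-∀

    A-BᵀA : ∀ i w′ → ∑[ w < n ] (a i w * ∑[ c < n ] (b c w * a c w′)) ≡ + r + k * a i w′
    A-BᵀA i w′ = begin
      ∑[ w < n ] (a i w * ∑[ c < n ] (b c w * a c w′))
        ≡⟨ sum-cong-≗ (λ w → *-distribˡ-sum (a i w) (λ c → b c w * a c w′)) ⟩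
      ∑[ w < n ] ∑[ c < n ] (a i w * (b c w * a c w′))
        ≡⟨ ∑-comm (λ w c → a i w * (b c w * a c w′)) ⟩
      ∑[ c < n ] ∑[ w < n ] (a i w * (b c w * a c w′))
        ≡⟨ sum-cong-≗ (λ c → trans (sum-cong-≗ (λ w → rearrange (a i w) (b c w) (a c w′)))
                                   (∑-scaleˡ (a c w′) (λ w → a i w * b c w))) ⟩
      ∑[ c < n ] (a c w′ * ∑[ w < n ] (a i w * b c w))
        ≡⟨ sum-cong-≗ (λ c → trans (cong (a c w′ *_) (AB i c)) (distribute (a c w′) k (δ i c))) ⟩
      ∑[ c < n ] (a c w′ + k * (δ i c * a c w′))
        ≡⟨ ∑-distrib-+ (λ c → a c w′) (λ c → k * (δ i c * a c w′)) ⟩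
      ∑[ c < n ] a c w′ + ∑[ c < n ] (k * (δ i c * a c w′))
        ≡⟨ cong₂ _+_ (colA w′) (trans (∑-scaleˡ k (λ c → δ i c * a c w′)) (cong (k *_) (∑-δʳ i (λ c → a c w′)))) ⟩
      + r + k * a i w′ ∎
      where
      open ≡-Reasoning
      rearrange : ∀ p q t → p * (q * t) ≡ t * (p * q)
      rearrange = solve-∀
      distribute : ∀ t κ d → t * (1ℤ + κ * d) ≡ t + κ * (d * t)
      distribute = solve-∀

    BᵀA−J−kI : Fin n → Fin n → ℤ
    BᵀA−J−kI w′ w = ∑[ c < n ] (b c w * a c w′) - (1ℤ + k * δ w w′)

    A-BᵀA−J−kI≡0 : ∀ w′ i → ∑[ w < n ] (a i w * BᵀA−J−kI w′ w) ≡ 0ℤ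
    A-BᵀA−J−kI≡0 w′ i = begin
      ∑[ w < n ] (a i w * BᵀA−J−kI w′ w)
        ≡⟨ sum-cong-≗ (λ w → expand k (a i w) (∑[ c < n ] (b c w * a c w′)) (δ w w′)) ⟩
      ∑[ w < n ] (a i w * ∑[ c < n ] (b c w * a c w′) - a i w - k * (δ w w′ * a i w))
        ≡⟨ ∑-distrib-minus _ (λ w → k * (δ w w′ * a i w)) ⟩
      ∑[ w < n ] (a i w * ∑[ c < n ] (b c w * a c w′) - a i w) - ∑[ w < n ] (k * (δ w w′ * a i w))
        ≡⟨ cong₂ _-_ (∑-distrib-minus (λ w → a i w * ∑[ c < n ] (b c w * a c w′)) (a i))
                     (trans (∑-scaleˡ k (λ w → δ w w′ * a i w)) (cong (k *_) (∑-δˡ w′ (a i)))) ⟩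
      ∑[ w < n ] (a i w * ∑[ c < n ] (b c w * a c w′)) - ∑[ w < n ] a i w - k * a i w′
        ≡⟨ cong₂ (λ s t → s - t - k * a i w′) (A-BᵀA i w′) (rowA i) ⟩
      + r + k * a i w′ - + r - k * a i w′
        ≡⟨ cancel (+ r) (k * a i w′) ⟩
      0ℤ ∎
      where
      open ≡-Reasoning
      expand : ∀ κ p q d → p * (q - (1ℤ + κ * d)) ≡ p * q - p - κ * (d * p)
      expand = solve-∀
      cancel : ∀ s t → s + t - s - t ≡ 0ℤ
      cancel = solve-∀

    -- A (rB − J)ᵀ = rk I makes A injective, and A kills every column of Bᵀ A − J − kI.
    transpose-identity : + r * k ≢ 0ℤ → ∀ w w′ → ∑[ c < n ] (b c w * a c w′) ≡ 1ℤ + k * δ w w′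
    transpose-identity rk≢0 w w′ =
      ℤ.i-j≡0⇒i≡j _ _ (rightInverse⇒injective a rB−J rk≢0 A-rB−J-diagonal (BᵀA−J−kI w′) (A-BᵀA−J−kI≡0 w′) w)

  regular⇒rows : ∀ {n r} {M : BMat n} → Regular n r M → ∀ i → ∑[ j < n ] ⟦ M ⟧ i j ≡ + r
  regular⇒rows {n} (rows , _) i = trans (sym (sumFin≡∑ n _)) (rows i)

  regular⇒columns : ∀ {n r} {M : BMat n} → Regular n r M → ∀ j → ∑[ i < n ] ⟦ M ⟧ i j ≡ + r
  regular⇒columns {n} (_ , columns) j = trans (sym (sumFin≡∑ n _)) (columns j)

  ∑⇒regular : ∀ {n r} {M : BMat n} →
    (∀ i → ∑[ j < n ] ⟦ M ⟧ i j ≡ + r) → (∀ j → ∑[ i < n ] ⟦ M ⟧ i j ≡ + r) → Regular n r M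
  ∑⇒regular {n} rows columns =
    (λ i → trans (sumFin≡∑ n _) (rows i)) , (λ j → trans (sumFin≡∑ n _) (columns j))

  JkI-one : ∀ n (i j : Fin n) → JkI n 1ℤ i j ≡ 1ℤ + δ i j
  JkI-one n i j with i ≟ j
  ... | yes _ = refl
  ... | no _ = refl

  kOf-cubic : ∀ {n s} → n ℕ.+ 1 ≡ 3 ℕ.* s → kOf n 3 s ≡ 1ℤ
  kOf-cubic {n} {s} n+1≡3s = begin
    + (3 ℕ.* s) - + n      ≡⟨ cong (λ m → + m - + n) n+1≡3s ⟨
    + (n ℕ.+ 1) - + n      ≡⟨ cong (_- + n) (ℤ.pos-+ n 1) ⟩
    + n + 1ℤ - + n         ≡⟨ cancel (+ n) ⟩
    1ℤ ∎
    where
    open ≡-Reasoning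
    cancel : ∀ ν → ν + 1ℤ - ν ≡ 1ℤ
    cancel = solve-∀

  lehman-equation⇒∑ : ∀ {n s} {A B : BMat n} → n ℕ.+ 1 ≡ 3 ℕ.* s →
    (∀ i j → prodT n A B i j ≡ JkI n (kOf n 3 s) i j) →
    ∀ i j → ∑[ w < n ] (⟦ A ⟧ i w * ⟦ B ⟧ j w) ≡ 1ℤ + δ i j
  lehman-equation⇒∑ {n} {s} {A} {B} n+1≡3s AB i j = begin
    ∑[ w < n ] (⟦ A ⟧ i w * ⟦ B ⟧ j w)   ≡⟨ sumFin≡∑ n _ ⟨
    prodT n A B i j                      ≡⟨ AB i j ⟩
    JkI n (kOf n 3 s) i j                ≡⟨ cong (λ k → JkI n k i j) (kOf-cubic {n} {s} n+1≡3s) ⟩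
    JkI n 1ℤ i j                         ≡⟨ JkI-one n i j ⟩
    1ℤ + δ i j ∎
    where open ≡-Reasoning

  ∑⇒lehman-equation : ∀ {n s} {A B : BMat n} → n ℕ.+ 1 ≡ 3 ℕ.* s →
    (∀ i j → ∑[ w < n ] (⟦ A ⟧ i w * ⟦ B ⟧ j w) ≡ 1ℤ + δ i j) →
    ∀ i j → prodT n A B i j ≡ JkI n (kOf n 3 s) i j
  ∑⇒lehman-equation {n} {s} {A} {B} n+1≡3s AB i j = begin
    prodT n A B i j                      ≡⟨ sumFin≡∑ n _ ⟩
    ∑[ w < n ] (⟦ A ⟧ i w * ⟦ B ⟧ j w)   ≡⟨ AB i j ⟩
    1ℤ + δ i j                           ≡⟨ JkI-one n i j ⟨
    JkI n 1ℤ i j                         ≡⟨ cong (λ k → JkI n k i j) (kOf-cubic {n} {s} n+1≡3s) ⟨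
    JkI n (kOf n 3 s) i j ∎
    where open ≡-Reasoning

module CubicLehman where

  open import Data.Bool using (true; false; _∧_; _∨_; not)
  open import Data.Nat using (ℕ; suc)
  import Data.Nat as ℕ
  open import Data.Fin using (Fin; suc)
  open import Data.Fin.Properties using (_≟_)
  open import Data.Fin.Patterns using (0F; 1F; 2F)
  open import Data.Integer using (ℤ; +_; 0ℤ; 1ℤ; _+_; _*_; _-_)
  import Data.Integer.Properties as ℤ
  open import Data.Integer.Tactic.RingSolver using (solve-∀)
  open import Algebra.Properties.Semiring.Sum ℤ.+-*-semiring using (sum-syntax; sum-cong-≗)
  open import Data.Product using (proj₁; proj₂)
  open import Data.Empty using (⊥; ⊥-elim)
  open import Relation.Nullary using (yes; no; contradiction)
  open import Relation.Nullary.Decidable using (⌊_⌋)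
  open import Relation.Binary.PropositionalEquality

  open IntegerMatrices

  pattern old x = suc (suc (suc x))

  upWitness : ∀ {n} → BMat n → (bL bR wL wR : Fin n) → BMat (3 ℕ.+ n)
  upWitness B bL bR wL wR 0F 0F = false
  upWitness B bL bR wL wR 0F 1F = true
  upWitness B bL bR wL wR 0F 2F = false
  upWitness B bL bR wL wR 0F (old w) = B bR w
  upWitness B bL bR wL wR 1F 0F = true
  upWitness B bL bR wL wR 1F 1F = false
  upWitness B bL bR wL wR 1F 2F = true
  upWitness B bL bR wL wR 1F (old w) = not (B bL w ∨ B bR w)
  upWitness B bL bR wL wR 2F 0F = false
  upWitness B bL bR wL wR 2F 1F = true
  upWitness B bL bR wL wR 2F 2F = false
  upWitness B bL bR wL wR 2F (old w) = B bL w
  upWitness B bL bR wL wR (old b) 0F = B b wR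
  upWitness B bL bR wL wR (old b) 1F = not (B b wL ∨ B b wR)
  upWitness B bL bR wL wR (old b) 2F = B b wL
  upWitness B bL bR wL wR (old b) (old w) = B b w

  module CubicRung
    {n : ℕ} (A B : BMat n)
    (rowA : ∀ i → ∑[ w < n ] ⟦ A ⟧ i w ≡ + 3) (colA : ∀ w → ∑[ i < n ] ⟦ A ⟧ i w ≡ + 3)
    (AB : ∀ i j → ∑[ w < n ] (⟦ A ⟧ i w * ⟦ B ⟧ j w) ≡ 1ℤ + δ i j)
    {bL bR wL wR : Fin n} (A-bR-wL : A bR wL ≡ true) (A-bL-wR : A bL wR ≡ true)
    (bL≢bR : bL ≢ bR) (wL≢wR : wL ≢ wR) (rung : IsRung A B bL wL)
    where

    a b : Fin n → Fin n → ℤ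
    a = ⟦ A ⟧
    b = ⟦ B ⟧

    A-bL-wL : A bL wL ≡ true
    A-bL-wL = proj₁ rung
    B-bL-wL : B bL wL ≡ false
    B-bL-wL = proj₂ rung

    BA : ∀ w w′ → ∑[ i < n ] (b i w * a i w′) ≡ 1ℤ + δ w w′
    BA w w′ = trans (transpose-identity {k = 1ℤ} A B rowA colA AB′ (λ ()) w w′)
                    (cong (λ t → 1ℤ + t) (ℤ.*-identityˡ (δ w w′)))
      where
      AB′ : ∀ i j → ∑[ w < n ] (a i w * b j w) ≡ 1ℤ + 1ℤ * δ i j
      AB′ i j = trans (AB i j) (cong (λ t → 1ℤ + t) (sym (ℤ.*-identityˡ (δ i j))))

    non-B-neighbours-of-white : ∀ w → ∑[ i < n ] (a i w * toℤ (not (B i w))) ≡ 1ℤ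
    non-B-neighbours-of-white w = begin
      ∑[ i < n ] (a i w * toℤ (not (B i w)))   ≡⟨ sum-cong-≗ (λ i → cong (a i w *_) (toℤ-not (B i w))) ⟩
      ∑[ i < n ] (a i w * (1ℤ - b i w))        ≡⟨ sum-cong-≗ (λ i → expand (a i w) (b i w)) ⟩
      ∑[ i < n ] (a i w - b i w * a i w)       ≡⟨ ∑-distrib-minus (λ i → a i w) (λ i → b i w * a i w) ⟩
      ∑[ i < n ] a i w - ∑[ i < n ] (b i w * a i w)
        ≡⟨ cong₂ _-_ (colA w) (trans (BA w w) (cong (λ t → 1ℤ + t) (δ-refl w))) ⟩
      1ℤ ∎
      where
      open ≡-Reasoning
      expand : ∀ x y → x * (1ℤ - y) ≡ x - y * x
      expand = solve-∀

    non-B-neighbours-of-black : ∀ i → ∑[ w < n ] (a i w * toℤ (not (B i w))) ≡ 1ℤ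
    non-B-neighbours-of-black i = begin
      ∑[ w < n ] (a i w * toℤ (not (B i w)))   ≡⟨ sum-cong-≗ (λ w → cong (a i w *_) (toℤ-not (B i w))) ⟩
      ∑[ w < n ] (a i w * (1ℤ - b i w))        ≡⟨ sum-cong-≗ (λ w → expand (a i w) (b i w)) ⟩
      ∑[ w < n ] (a i w - a i w * b i w)       ≡⟨ ∑-distrib-minus (a i) (λ w → a i w * b i w) ⟩
      ∑[ w < n ] a i w - ∑[ w < n ] (a i w * b i w)
        ≡⟨ cong₂ _-_ (rowA i) (trans (AB i i) (cong (λ t → 1ℤ + t) (δ-refl i))) ⟩
      1ℤ ∎
      where
      open ≡-Reasoning
      expand : ∀ x y → x * (1ℤ - y) ≡ x - x * y
      expand = solve-∀

    -- Otherwise b_R w_L would be a second rung at w_L.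
    B-bR-wL : B bR wL ≡ true
    B-bR-wL with B bR wL in B-bR-wL≡
    ... | true = refl
    ... | false = ⊥-elim (∑≢1-of-two-units (λ i → toℤ-*-nonneg (A i wL) (not (B i wL))) bL≢bR
                            rung-bL rung-bR (non-B-neighbours-of-white wL))
      where
      rung-bL : a bL wL * toℤ (not (B bL wL)) ≡ 1ℤ
      rung-bL rewrite A-bL-wL | B-bL-wL = refl
      rung-bR : a bR wL * toℤ (not (B bR wL)) ≡ 1ℤ
      rung-bR rewrite A-bR-wL | B-bR-wL≡ = refl

    -- Otherwise b_L w_R would be a second rung at b_L.
    B-bL-wR : B bL wR ≡ true
    B-bL-wR with B bL wR in B-bL-wR≡
    ... | true = refl
    ... | false = ⊥-elim (∑≢1-of-two-units (λ w → toℤ-*-nonneg (A bL w) (not (B bL w))) wL≢wR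
                            rung-wL rung-wR (non-B-neighbours-of-black bL))
      where
      rung-wL : a bL wL * toℤ (not (B bL wL)) ≡ 1ℤ
      rung-wL rewrite A-bL-wL | B-bL-wL = refl
      rung-wR : a bL wR * toℤ (not (B bL wR)) ≡ 1ℤ
      rung-wR rewrite A-bL-wR | B-bL-wR≡ = refl

    -- For w ≢ w_L the entry (Bᵀ A)(w, w_L) = 1 would count both b_L and b_R.
    B-bL-B-bR-disjoint : ∀ w → B bL w ≡ true → B bR w ≡ true → ⊥
    B-bL-B-bR-disjoint w B-bL-w B-bR-w with w ≟ wL
    ... | yes refl = contradiction (trans (sym B-bL-w) B-bL-wL) λ ()
    ... | no w≢wL = ∑≢1-of-two-units (λ i → toℤ-*-nonneg (B i w) (A i wL)) bL≢bR
                      bL-term bR-term (trans (BA w wL) (cong (λ t → 1ℤ + t) (δ-≢ w≢wL)))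
      where
      bL-term : b bL w * a bL wL ≡ 1ℤ
      bL-term rewrite B-bL-w | A-bL-wL = refl
      bR-term : b bR w * a bR wL ≡ 1ℤ
      bR-term rewrite B-bR-w | A-bR-wL = refl

    -- For i ≢ b_L the entry (A Bᵀ)(b_L, i) = 1 would count both w_L and w_R.
    B-wL-B-wR-disjoint : ∀ i → B i wL ≡ true → B i wR ≡ true → ⊥
    B-wL-B-wR-disjoint i B-i-wL B-i-wR with bL ≟ i
    ... | yes refl = contradiction (trans (sym B-i-wL) B-bL-wL) λ ()
    ... | no bL≢i = ∑≢1-of-two-units (λ w → toℤ-*-nonneg (A bL w) (B i w)) wL≢wR
                      wL-term wR-term (trans (AB bL i) (cong (λ t → 1ℤ + t) (δ-≢ bL≢i)))
      where
      wL-term : a bL wL * b i wL ≡ 1ℤ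
      wL-term rewrite A-bL-wL | B-i-wL = refl
      wR-term : a bL wR * b i wR ≡ 1ℤ
      wR-term rewrite A-bL-wR | B-i-wR = refl

    B-bR-wR : B bR wR ≡ false
    B-bR-wR with B bR wR in B-bR-wR≡
    ... | false = refl
    ... | true = ⊥-elim (B-bL-B-bR-disjoint wR B-bL-wR B-bR-wR≡)

    U B↑ : BMat (3 ℕ.+ n)
    U = up A bL bR wL wR
    B↑ = upWitness B bL bR wL wR
    u b↑ : Fin (3 ℕ.+ n) → Fin (3 ℕ.+ n) → ℤ
    u = ⟦ U ⟧
    b↑ = ⟦ B↑ ⟧

    ∑-split₃ : (f : Fin (3 ℕ.+ n) → ℤ) {t : ℤ} → ∑[ w < n ] f (old w) ≡ t →
      ∑[ l < 3 ℕ.+ n ] f l ≡ f 0F + (f 1F + (f 2F + t))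
    ∑-split₃ f eq = cong (λ t → f 0F + (f 1F + (f 2F + t))) eq

    u-old-old : ∀ i w → u (old i) (old w) ≡ a i w - δ i bR * δ w wL - δ i bL * δ w wR
    u-old-old i w = trans (toℤ-∧-nor e⇒A f⇒A e∧f)
      (cong₂ (λ x y → a i w - x - y) (toℤ-∧ ⌊ i ≟ bR ⌋ ⌊ w ≟ wL ⌋) (toℤ-∧ ⌊ i ≟ bL ⌋ ⌊ w ≟ wR ⌋))
      where
      e⇒A : (⌊ i ≟ bR ⌋ ∧ ⌊ w ≟ wL ⌋) ≡ true → A i w ≡ true
      e⇒A eq with i ≟ bR | w ≟ wL
      e⇒A _  | yes refl | yes refl = A-bR-wL
      e⇒A () | yes _    | no _
      e⇒A () | no _     | _
      f⇒A : (⌊ i ≟ bL ⌋ ∧ ⌊ w ≟ wR ⌋) ≡ true → A i w ≡ true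
      f⇒A eq with i ≟ bL | w ≟ wR
      f⇒A _  | yes refl | yes refl = A-bL-wR
      f⇒A () | yes _    | no _
      f⇒A () | no _     | _
      e∧f : (⌊ i ≟ bR ⌋ ∧ ⌊ w ≟ wL ⌋) ≡ true → (⌊ i ≟ bL ⌋ ∧ ⌊ w ≟ wR ⌋) ≡ true → ⊥
      e∧f eq eq′ with i ≟ bR | i ≟ bL
      e∧f _  _  | yes refl | yes refl = bL≢bR refl
      e∧f () _  | no _     | _
      e∧f _  () | yes _    | no _

    ∑-u-old-row : ∀ i (g : Fin n → ℤ) →
      ∑[ w < n ] (u (old i) (old w) * g w) ≡ ∑[ w < n ] (a i w * g w) - δ i bR * g wL - δ i bL * g wR
    ∑-u-old-row i g = begin
      ∑[ w < n ] (u (old i) (old w) * g w)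
        ≡⟨ sum-cong-≗ (λ w → trans (cong (_* g w) (u-old-old i w))
                                   (expand (a i w) (δ i bR) (δ w wL) (δ i bL) (δ w wR) (g w))) ⟩
      ∑[ w < n ] (a i w * g w - δ i bR * (δ w wL * g w) - δ i bL * (δ w wR * g w))
        ≡⟨ trans (∑-distrib-minus _ (λ w → δ i bL * (δ w wR * g w)))
                 (cong₂ _-_ (∑-distrib-minus (λ w → a i w * g w) _) (∑-scaleˡ (δ i bL) (λ w → δ w wR * g w))) ⟩
      ∑[ w < n ] (a i w * g w) - ∑[ w < n ] (δ i bR * (δ w wL * g w)) - δ i bL * ∑[ w < n ] (δ w wR * g w)
        ≡⟨ cong₂ (λ x y → ∑[ w < n ] (a i w * g w) - x - δ i bL * y)
                 (trans (∑-scaleˡ (δ i bR) (λ w → δ w wL * g w)) (cong (δ i bR *_) (∑-δˡ wL g))) (∑-δˡ wR g) ⟩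
      ∑[ w < n ] (a i w * g w) - δ i bR * g wL - δ i bL * g wR ∎
      where
      open ≡-Reasoning
      expand : ∀ x c₁ d₁ c₂ d₂ y → (x - c₁ * d₁ - c₂ * d₂) * y ≡ x * y - c₁ * (d₁ * y) - c₂ * (d₂ * y)
      expand = solve-∀

    ∑-u-old-column : ∀ w → ∑[ i < n ] u (old i) (old w) ≡ + 3 - δ w wL - δ w wR
    ∑-u-old-column w = begin
      ∑[ i < n ] u (old i) (old w)
        ≡⟨ sum-cong-≗ (λ i → trans (u-old-old i w) (commute (a i w) (δ i bR) (δ w wL) (δ i bL) (δ w wR))) ⟩
      ∑[ i < n ] (a i w - δ w wL * δ i bR - δ w wR * δ i bL)
        ≡⟨ trans (∑-distrib-minus _ (λ i → δ w wR * δ i bL))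
                 (cong₂ _-_ (∑-distrib-minus (λ i → a i w) _) (∑-scaleˡ (δ w wR) (λ i → δ i bL))) ⟩
      ∑[ i < n ] a i w - ∑[ i < n ] (δ w wL * δ i bR) - δ w wR * ∑[ i < n ] δ i bL
        ≡⟨ cong₂ (λ x y → x - y - δ w wR * ∑[ i < n ] δ i bL) (colA w) (∑-scaleˡ (δ w wL) (λ i → δ i bR)) ⟩
      + 3 - δ w wL * ∑[ i < n ] δ i bR - δ w wR * ∑[ i < n ] δ i bL
        ≡⟨ cong₂ (λ x y → + 3 - δ w wL * x - δ w wR * y) (∑-δ bR) (∑-δ bL) ⟩
      + 3 - δ w wL * 1ℤ - δ w wR * 1ℤ
        ≡⟨ cong₂ (λ x y → + 3 - x - y) (ℤ.*-identityʳ (δ w wL)) (ℤ.*-identityʳ (δ w wR)) ⟩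
      + 3 - δ w wL - δ w wR ∎
      where
      open ≡-Reasoning
      commute : ∀ x c₁ d₁ c₂ d₂ → x - c₁ * d₁ - c₂ * d₂ ≡ x - d₁ * c₁ - d₂ * c₂
      commute = solve-∀

    b↑-b₁-old : ∀ w → b↑ 1F (old w) ≡ 1ℤ - b bL w - b bR w
    b↑-b₁-old w = toℤ-nor (B-bL-B-bR-disjoint w)

    b↑-old-w₁ : ∀ j → b↑ (old j) 1F ≡ 1ℤ - b j wL - b j wR
    b↑-old-w₁ j = toℤ-nor (B-wL-B-wR-disjoint j)

    product-b₀ : ∀ j → ∑[ l < 3 ℕ.+ n ] (u 0F l * b↑ j l) ≡ 1ℤ + δ 0F j
    product-b₀ j = trans (∑-split₃ (λ l → u 0F l * b↑ j l) (∑-δˡ wL (λ w → b↑ j (old w)))) (entries j)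
      where
      tidy : ∀ x y → 1ℤ * y + (1ℤ * (1ℤ - x - y) + (0ℤ * x + x)) ≡ 1ℤ + 0ℤ
      tidy = solve-∀
      entries : ∀ j → 1ℤ * b↑ j 0F + (1ℤ * b↑ j 1F + (0ℤ * b↑ j 2F + b↑ j (old wL))) ≡ 1ℤ + δ 0F j
      entries 0F rewrite B-bR-wL = refl
      entries 1F rewrite B-bL-wL | B-bR-wL = refl
      entries 2F rewrite B-bL-wL = refl
      entries (old j) rewrite b↑-old-w₁ j = tidy (b j wL) (b j wR)

    product-b₁ : ∀ j → ∑[ l < 3 ℕ.+ n ] (u 1F l * b↑ j l) ≡ 1ℤ + δ 1F j
    product-b₁ j = trans (∑-split₃ (λ l → u 1F l * b↑ j l) (∑-zero (λ w → ℤ.*-zeroˡ (b↑ j (old w))))) (entries j)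
      where
      tidy : ∀ x y → 1ℤ * y + (1ℤ * (1ℤ - x - y) + (1ℤ * x + 0ℤ)) ≡ 1ℤ + 0ℤ
      tidy = solve-∀
      entries : ∀ j → 1ℤ * b↑ j 0F + (1ℤ * b↑ j 1F + (1ℤ * b↑ j 2F + 0ℤ)) ≡ 1ℤ + δ 1F j
      entries 0F = refl
      entries 1F = refl
      entries 2F = refl
      entries (old j) rewrite b↑-old-w₁ j = tidy (b j wL) (b j wR)

    product-b₂ : ∀ j → ∑[ l < 3 ℕ.+ n ] (u 2F l * b↑ j l) ≡ 1ℤ + δ 2F j
    product-b₂ j = trans (∑-split₃ (λ l → u 2F l * b↑ j l) (∑-δˡ wR (λ w → b↑ j (old w)))) (entries j)
      where
      tidy : ∀ x y → 0ℤ * y + (1ℤ * (1ℤ - x - y) + (1ℤ * x + y)) ≡ 1ℤ + 0ℤ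
      tidy = solve-∀
      entries : ∀ j → 0ℤ * b↑ j 0F + (1ℤ * b↑ j 1F + (1ℤ * b↑ j 2F + b↑ j (old wR))) ≡ 1ℤ + δ 2F j
      entries 0F rewrite B-bR-wR = refl
      entries 1F rewrite B-bL-wR = refl
      entries 2F rewrite B-bL-wR = refl
      entries (old j) rewrite b↑-old-w₁ j = tidy (b j wL) (b j wR)

    ∑-a-b↑-b₁ : ∀ i → ∑[ w < n ] (a i w * b↑ 1F (old w)) ≡ 1ℤ - δ i bL - δ i bR
    ∑-a-b↑-b₁ i = begin
      ∑[ w < n ] (a i w * b↑ 1F (old w))
        ≡⟨ sum-cong-≗ (λ w → trans (cong (a i w *_) (b↑-b₁-old w)) (expand (a i w) (b bL w) (b bR w))) ⟩
      ∑[ w < n ] (a i w - a i w * b bL w - a i w * b bR w)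
        ≡⟨ trans (∑-distrib-minus _ (λ w → a i w * b bR w))
                 (cong (_- ∑[ w < n ] (a i w * b bR w)) (∑-distrib-minus (a i) (λ w → a i w * b bL w))) ⟩
      ∑[ w < n ] a i w - ∑[ w < n ] (a i w * b bL w) - ∑[ w < n ] (a i w * b bR w)
        ≡⟨ cong₂ (λ x y → x - y - ∑[ w < n ] (a i w * b bR w)) (rowA i) (AB i bL) ⟩
      + 3 - (1ℤ + δ i bL) - ∑[ w < n ] (a i w * b bR w)
        ≡⟨ cong (λ y → + 3 - (1ℤ + δ i bL) - y) (AB i bR) ⟩
      + 3 - (1ℤ + δ i bL) - (1ℤ + δ i bR)
        ≡⟨ tidy (δ i bL) (δ i bR) ⟩
      1ℤ - δ i bL - δ i bR ∎
      where
      open ≡-Reasoning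
      expand : ∀ x y z → x * (1ℤ - y - z) ≡ x - x * y - x * z
      expand = solve-∀
      tidy : ∀ x y → + 3 - (1ℤ + x) - (1ℤ + y) ≡ 1ℤ - x - y
      tidy = solve-∀

    product-old : ∀ i j → ∑[ l < 3 ℕ.+ n ] (u (old i) l * b↑ j l) ≡ 1ℤ + δ (old i) j
    product-old i j =
      trans (∑-split₃ (λ l → u (old i) l * b↑ j l) (∑-u-old-row i (λ w → b↑ j (old w)))) (entries j)
      where
      entries : ∀ j → δ i bL * b↑ j 0F + (0ℤ * b↑ j 1F + (δ i bR * b↑ j 2F +
                  (∑[ w < n ] (a i w * b↑ j (old w)) - δ i bR * b↑ j (old wL) - δ i bL * b↑ j (old wR))))
                ≡ 1ℤ + δ (old i) j
      entries 0F rewrite AB i bR | B-bR-wL | B-bR-wR = tidy (δ i bL) (δ i bR)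
        where
        tidy : ∀ x y → x * 0ℤ + (0ℤ * 1ℤ + (y * 0ℤ + (1ℤ + y - y * 1ℤ - x * 0ℤ))) ≡ 1ℤ + 0ℤ
        tidy = solve-∀
      entries 1F rewrite ∑-a-b↑-b₁ i | B-bL-wL | B-bR-wL | B-bL-wR = tidy (δ i bL) (δ i bR)
        where
        tidy : ∀ x y → x * 1ℤ + (0ℤ * 0ℤ + (y * 1ℤ + (1ℤ - x - y - y * 0ℤ - x * 0ℤ))) ≡ 1ℤ + 0ℤ
        tidy = solve-∀
      entries 2F rewrite AB i bL | B-bL-wL | B-bL-wR = tidy (δ i bL) (δ i bR)
        where
        tidy : ∀ x y → x * 0ℤ + (0ℤ * 1ℤ + (y * 0ℤ + (1ℤ + x - y * 0ℤ - x * 1ℤ))) ≡ 1ℤ + 0ℤ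
        tidy = solve-∀
      entries (old j) rewrite AB i j | δ-suc (suc (suc i)) (suc (suc j)) | δ-suc (suc i) (suc j) | δ-suc i j
        = tidy (δ i bL) (δ i bR) (b j wL) (b j wR) (δ i j)
        where
        tidy : ∀ x y p q d → x * q + (0ℤ * (1ℤ - p - q) + (y * p + (1ℤ + d - y * p - x * q))) ≡ 1ℤ + d
        tidy = solve-∀

    up-product : ∀ i j → ∑[ l < 3 ℕ.+ n ] (u i l * b↑ j l) ≡ 1ℤ + δ i j
    up-product 0F = product-b₀
    up-product 1F = product-b₁
    up-product 2F = product-b₂
    up-product (old i) = product-old i

    up-rows : ∀ i → ∑[ l < 3 ℕ.+ n ] u i l ≡ + 3
    up-rows 0F = ∑-split₃ (u 0F) (∑-δ wL)
    up-rows 1F = ∑-split₃ (u 1F) (∑-zero {f = λ w → u 1F (old w)} (λ _ → refl))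
    up-rows 2F = ∑-split₃ (u 2F) (∑-δ wR)
    up-rows (old i) = trans (∑-split₃ (u (old i)) old-part) (tidy (δ i bL) (δ i bR))
      where
      old-part : ∑[ w < n ] u (old i) (old w) ≡ + 3 - δ i bR * 1ℤ - δ i bL * 1ℤ
      old-part = begin
        ∑[ w < n ] u (old i) (old w)                   ≡⟨ sum-cong-≗ (λ w → ℤ.*-identityʳ (u (old i) (old w))) ⟨
        ∑[ w < n ] (u (old i) (old w) * 1ℤ)            ≡⟨ ∑-u-old-row i (λ _ → 1ℤ) ⟩
        ∑[ w < n ] (a i w * 1ℤ) - δ i bR * 1ℤ - δ i bL * 1ℤ
          ≡⟨ cong (λ t → t - δ i bR * 1ℤ - δ i bL * 1ℤ)
                  (trans (sum-cong-≗ (λ w → ℤ.*-identityʳ (a i w))) (rowA i)) ⟩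
        + 3 - δ i bR * 1ℤ - δ i bL * 1ℤ ∎
        where open ≡-Reasoning
      tidy : ∀ x y → x + (0ℤ + (y + (+ 3 - y * 1ℤ - x * 1ℤ))) ≡ + 3
      tidy = solve-∀

    up-columns : ∀ l → ∑[ i < 3 ℕ.+ n ] u i l ≡ + 3
    up-columns 0F = ∑-split₃ (λ i → u i 0F) (∑-δ bL)
    up-columns 1F = ∑-split₃ (λ i → u i 1F) (∑-zero {f = λ i → u (old i) 1F} (λ _ → refl))
    up-columns 2F = ∑-split₃ (λ i → u i 2F) (∑-δ bR)
    up-columns (old w) = trans (∑-split₃ (λ i → u i (old w)) (∑-u-old-column w)) (tidy (δ w wL) (δ w wR))
      where
      tidy : ∀ x y → x + (0ℤ + (y + (+ 3 - x - y))) ≡ + 3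
      tidy = solve-∀

    module _ {s : ℕ} (n+1≡3s : n ℕ.+ 1 ≡ 3 ℕ.* s) (B-regular : Regular n s B) where

      rowB : ∀ i → ∑[ w < n ] b i w ≡ + s
      rowB = regular⇒rows B-regular

      colB : ∀ w → ∑[ i < n ] b i w ≡ + s
      colB = regular⇒columns B-regular

      ∑-complement-pair : ∀ (f g : Fin n → ℤ) → ∑[ i < n ] f i ≡ + s → ∑[ i < n ] g i ≡ + s →
        ∑[ i < n ] (1ℤ - f i - g i) ≡ + s - 1ℤ
      ∑-complement-pair f g ∑f ∑g = begin
        ∑[ i < n ] (1ℤ - f i - g i)
          ≡⟨ trans (∑-distrib-minus _ g) (cong (_- ∑[ i < n ] g i) (∑-distrib-minus (λ _ → 1ℤ) f)) ⟩
        ∑[ i < n ] 1ℤ - ∑[ i < n ] f i - ∑[ i < n ] g i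
          ≡⟨ cong₂ (λ x y → x - y - ∑[ i < n ] g i) (∑-one n) ∑f ⟩
        + n - + s - ∑[ i < n ] g i
          ≡⟨ cong (λ y → + n - + s - y) ∑g ⟩
        + n - + s - + s
          ≡⟨ regroup (+ n) (+ s) ⟩
        + n + 1ℤ - + s - + s - 1ℤ
          ≡⟨ cong (λ t → t - + s - + s - 1ℤ) (trans (sym (ℤ.pos-+ n 1)) (trans (cong +_ n+1≡3s) (ℤ.pos-* 3 s))) ⟩
        + 3 * + s - + s - + s - 1ℤ
          ≡⟨ collect (+ s) ⟩
        + s - 1ℤ ∎
        where
        open ≡-Reasoning
        regroup : ∀ ν σ → ν - σ - σ ≡ ν + 1ℤ - σ - σ - 1ℤ
        regroup = solve-∀
        collect : ∀ σ → + 3 * σ - σ - σ - 1ℤ ≡ σ - 1ℤ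
        collect = solve-∀

      1+0+1+[σ-1] : ∀ σ → 1ℤ + (0ℤ + (1ℤ + (σ - 1ℤ))) ≡ 1ℤ + σ
      1+0+1+[σ-1] = solve-∀

      y+[1-x-y+[x+σ]] : ∀ x y σ → y + (1ℤ - x - y + (x + σ)) ≡ 1ℤ + σ
      y+[1-x-y+[x+σ]] = solve-∀

      upWitness-rows : ∀ j → ∑[ l < 3 ℕ.+ n ] b↑ j l ≡ + suc s
      upWitness-rows 0F = ∑-split₃ (b↑ 0F) (rowB bR)
      upWitness-rows 1F =
        trans (∑-split₃ (b↑ 1F) (trans (sum-cong-≗ b↑-b₁-old) (∑-complement-pair (b bL) (b bR) (rowB bL) (rowB bR))))
              (1+0+1+[σ-1] (+ s))
      upWitness-rows 2F = ∑-split₃ (b↑ 2F) (rowB bL)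
      upWitness-rows (old j) rewrite b↑-old-w₁ j | rowB j = y+[1-x-y+[x+σ]] (b j wL) (b j wR) (+ s)

      upWitness-columns : ∀ l → ∑[ j < 3 ℕ.+ n ] b↑ j l ≡ + suc s
      upWitness-columns 0F = ∑-split₃ (λ j → b↑ j 0F) (colB wR)
      upWitness-columns 1F =
        trans (∑-split₃ (λ j → b↑ j 1F) (trans (sum-cong-≗ b↑-old-w₁)
                (∑-complement-pair (λ j → b j wL) (λ j → b j wR) (colB wL) (colB wR))))
              (1+0+1+[σ-1] (+ s))
      upWitness-columns 2F = ∑-split₃ (λ j → b↑ j 2F) (colB wL)
      upWitness-columns (old w) rewrite b↑-b₁-old w | colB w = y+[1-x-y+[x+σ]] (b bL w) (b bR w) (+ s)

open import Data.Bool using (Bool; true; false)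
open import Data.Nat using (ℕ; suc; _+_; _*_)
open import Data.Nat.Properties using (*-suc)
open import Data.Fin using (Fin)
import Data.Integer.Properties as ℤ
open import Data.Product using (_,_)
open import Data.Sum using (inj₂)
open import Relation.Binary.PropositionalEquality using (_≡_; _≢_; sym; trans; cong)
open IntegerMatrices
open CubicLehman

corollary3p5 : (n s : ℕ) → n + 1 ≡ 3 * s →
    (A B : BMat n) → LehmanWitness n 3 s A B →
    (bL bR wL wR : Fin n) →
    A bR wL ≡ true → A bL wR ≡ true →
    bL ≢ bR → wL ≢ wR →
    IsRung A B bL wL →
    Lehman (3 + n) 3 (suc s) (up A bL bR wL wR)
corollary3p5 n s n+1≡3s A B (A-regular , B-regular , _ , AB) bL bR wL wR A-bR-wL A-bL-wR bL≢bR wL≢wR rung =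
  B↑ ,
  ∑⇒regular {M = U} up-rows up-columns ,
  ∑⇒regular {M = B↑} (upWitness-rows n+1≡3s B-regular) (upWitness-columns n+1≡3s B-regular) ,
  inj₂ (ℤ.≤-reflexive (sym (kOf-cubic {3 + n} {suc s} n↑+1≡3s↑))) ,
  ∑⇒lehman-equation {s = suc s} {U} {B↑} n↑+1≡3s↑ up-product
  where
  open CubicRung A B (regular⇒rows A-regular) (regular⇒columns A-regular)
    (lehman-equation⇒∑ {s = s} {A} {B} n+1≡3s AB) A-bR-wL A-bL-wR bL≢bR wL≢wR rung
  n↑+1≡3s↑ : 3 + n + 1 ≡ 3 * suc s
  n↑+1≡3s↑ = trans (cong (3 +_) n+1≡3s) (sym (*-suc 3 s))
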